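{- Let $G$ and $G^{*}$ be graphs with standard walk matrices $W$ and $W^{*}$, respectively, and let $n$ be the number of vertices of $G$. Suppose that $W$ has rank $\geq n-1$. Then $G$ is isomorphic to $G^{*}$ if and only if ${\rm lex}(W)={\rm lex}(W^{*})$.
   Context: Graphs are finite, simple and undirected. For a graph with vertex set $V=\{v_1,\dots,v_n\}$ and adjacency matrix $A$, the standard walk matrix is the $n\times n$ matrix $W=[{\rm e},A{\rm e},A^2{\rm e},\dots,A^{n-1}{\rm e}]$ whose columns are $A^k{\rm e}$, where ${\rm e}=(1,\dots,1)^{\tt T}$ is the all-ones vector; its row indexed by $v_\ell$ lists the numbers of walks of lengths $0,\dots,n-1$ starting at $v_\ell$. For a matrix $W$, ${\rm lex}(W)$ denotes the matrix obtained from $W$ by permuting its rows so that they appear in lexicographical order. -}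

module Defs where

open import Data.Nat using (ℕ; zero; suc; _∸_; _≤ᵇ_; _≡ᵇ_)
import Data.Nat as ℕ
open import Data.Bool using (Bool; true; false; if_then_else_)
open import Data.Fin using (Fin)
open import Data.List using (List; []; _∷_; map; upTo; allFin)
open import Data.Rational using (ℚ; 0ℚ; _+_; _*_; _/_)
open import Data.Integer using (+_)
open import Data.Product using (Σ; _×_)
open import Relation.Binary.PropositionalEquality using (_≡_)
open import Function.Bundles using (_↔_; Inverse)
open import Function.Definitions using (Injective)

record Graph (n : ℕ) : Set where
  field
    adj   : Fin n → Fin n → Bool
    sym   : ∀ u v → adj u v ≡ adj v u
    loopless : ∀ v → adj v v ≡ false
open Graph public

sumFin : ∀ {n} → (Fin n → ℕ) → ℕ
sumFin {zero}  f = 0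
sumFin {suc n} f = f Fin.zero ℕ.+ sumFin (λ i → f (Fin.suc i))

sumFinℚ : ∀ {n} → (Fin n → ℚ) → ℚ
sumFinℚ {zero}  f = 0ℚ
sumFinℚ {suc n} f = f Fin.zero + sumFinℚ (λ i → f (Fin.suc i))

A : ∀ {n} → Graph n → Fin n → Fin n → ℕ
A G u v = if adj G u v then 1 else 0

-- (A^k e)_v : number of walks of length k starting at v
walks : ∀ {n} → Graph n → ℕ → Fin n → ℕ
walks G zero    v = 1
walks G (suc k) v = sumFin (λ u → A G v u ℕ.* walks G k u)

-- entry (v, k) of the standard walk matrix W = [e, Ae, ..., A^{n-1}e]
Wentry : ∀ {n} → Graph n → Fin n → Fin n → ℕ
Wentry G v k = walks G (Data.Fin.toℕ k) v

Wrow : ∀ {n} → Graph n → Fin n → List ℕ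
Wrow {n} G v = map (λ k → walks G k v) (upTo n)

Wrows : ∀ {n} → Graph n → List (List ℕ)
Wrows {n} G = map (Wrow G) (allFin n)

lexLeq : List ℕ → List ℕ → Bool
lexLeq []       _        = true
lexLeq (_ ∷ _)  []       = false
lexLeq (x ∷ xs) (y ∷ ys) =
  if x ≡ᵇ y then lexLeq xs ys else (x ≤ᵇ y)

insert : List ℕ → List (List ℕ) → List (List ℕ)
insert r []       = r ∷ []
insert r (s ∷ ss) = if lexLeq r s then r ∷ s ∷ ss else s ∷ insert r ss

sortRows : List (List ℕ) → List (List ℕ)
sortRows []       = []
sortRows (r ∷ rs) = insert r (sortRows rs)

lexW : ∀ {n} → Graph n → List (List ℕ)
lexW G = sortRows (Wrows G)

-- rank W ≥ n - 1 (over ℚ): there are n-1 distinct columns of W that are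
-- linearly independent over ℚ.
toℚ : ℕ → ℚ
toℚ m = (+ m) / 1

RankAtLeast : ∀ {n} → Graph n → ℕ → Set
RankAtLeast {n} G r =
  Σ (Fin r → Fin n) λ cols → Injective _≡_ _≡_ cols ×
    (∀ (c : Fin r → ℚ) →
       (∀ v → sumFinℚ (λ i → c i * toℚ (Wentry G v (cols i))) ≡ 0ℚ) →
       ∀ i → c i ≡ 0ℚ)

Isomorphic : ∀ {n m} → Graph n → Graph m → Set
Isomorphic {n} {m} G H =
  Σ (Fin n ↔ Fin m) λ σ →
    ∀ u v → adj G u v ≡ adj H (Inverse.to σ u) (Inverse.to σ v)

module Submission where

-- (⇒) An isomorphism σ preserves walk counts, so the rows of W* are the
-- rows of W reindexed by σ, and sorting is invariant under permutations.
-- (⇐) Equal sorted row lists are permutations of each other, hence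
-- reindexings by a bijection σ.  Pulling G* back along σ gives a graph H
-- on the vertices of G with the same walk counts of all lengths < n, and
-- the rank condition forces H = G (walk-determined).  That last step is
-- linear algebra over ℚ, developed first:
--   * p > d vectors in ℚᵈ are dependent (Gaussian elimination), hence so
--     are p vectors in the span of fewer than p vectors;
--   * in a Krylov sequence w_{k+1} = A w_k a dependence among w₀, …, w_{m-1}
--     puts every w_t in a span of fewer than m vectors, so by the rank
--     hypothesis e, Ae, …, A^{n-2}e are independent;
--   * Δ = A(G) - A(H) annihilates these n-1 vectors, while a nonzero entry
--     of the symmetric, zero-diagonal Δ yields a 2×2 block of rank 2.
-- The file then treats sorting of rows and reindexing of lists, and
-- derives the theorem at the end.

open import Defs hiding (sym)

open import Algebra.Bundles using (CommutativeRing)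
import Algebra.Properties.CommutativeMonoid.Sum
open import Data.Bool using (true; false; T; if_then_else_)
open import Data.Empty using (⊥-elim)
open import Data.Fin as Fin using (Fin; punchIn; toℕ)
open import Data.Fin.Permutation using (Permutation; _⟨$⟩ʳ_; _∘ₚ_; cast-id; ↔⇒≡)
import Data.Fin.Properties as FinP
import Data.Integer as ℤ
import Data.Integer.Properties as ℤP
open import Data.List using (List; []; _∷_; map; tabulate; lookup; upTo; applyUpTo)
import Data.List.Properties as ListP
open import Data.List.Relation.Binary.Permutation.Homogeneous using (onIndices)
open import Data.List.Relation.Binary.Permutation.Propositional using (_↭_; ↭-sym; ↭-trans; ↭⇒↭ₛ)
import Data.List.Relation.Binary.Permutation.Propositional.Properties as ↭P
import Data.List.Relation.Binary.Permutation.Setoid.Properties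
open import Data.List.Relation.Binary.Pointwise using (Pointwise-≡⇒≡)
open import Data.List.Relation.Unary.Sorted.TotalOrder.Properties using (↗↭↗⇒≋)
open import Data.Nat as ℕ using (ℕ; zero; suc; s≤s; z≤n; _∸_; _≡ᵇ_)
import Data.Nat.Properties as ℕP
open import Data.Product using (Σ; ∃; _×_; _,_; proj₁; proj₂)
open import Data.Rational as ℚ using (ℚ; 0ℚ; 1ℚ; _+_; _*_; -_; 1/_)
import Data.Rational.Properties as ℚP
open import Data.Rational.Solver using (module +-*-Solver)
import Data.Rational.Unnormalised as ℚᵘ
import Data.Rational.Unnormalised.Properties as ℚᵘP
open import Data.Sum using (_⊎_; inj₁; inj₂)
open import Data.Unit using (tt)
open import Data.Vec.Functional using (Vector; insertAt)
open import Data.Vec.Functional.Properties using (insertAt-lookup; insertAt-punchIn)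
open import Function using (_∘_)
open import Function.Bundles using (_↔_; _⇔_; mk⇔)
open import Relation.Binary.Bundles using (DecTotalOrder)
open import Relation.Binary.Definitions using (tri<; tri≈; tri>)
open import Relation.Binary.PropositionalEquality
open import Relation.Nullary using (yes; no; ¬_)
open import Relation.Nullary.Decidable using (T?; ¬?; decidable-stable)

open import Algebra.Properties.Semiring.Sum (CommutativeRing.semiring ℚP.+-*-commutativeRing)
  using (sum-syntax; sum-remove; sum-init-last; sum-cong-≗; sum-replicate-zero;
         ∑-distrib-+; ∑-comm; *-distribˡ-sum; *-distribʳ-sum)
module ℕΣ = Algebra.Properties.CommutativeMonoid.Sum ℕP.+-0-commutativeMonoid
open +-*-Solver

∑-zero : ∀ {n} (f : Fin n → ℚ) → (∀ i → f i ≡ 0ℚ) → ∑[ i < n ] f i ≡ 0ℚ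
∑-zero {n} f f≡0 = trans (sum-cong-≗ f≡0) (sum-replicate-zero n)

Nontrivial : ∀ {p} → Vector ℚ p → Set
Nontrivial c = ∃ λ i → c i ≢ 0ℚ

lincomb : ∀ {p d} → (Fin p → Vector ℚ d) → Vector ℚ p → Vector ℚ d
lincomb {p} v c x = ∑[ i < p ] (c i * v i x)

Dependent : ∀ {p d} → (Fin p → Vector ℚ d) → Set
Dependent v = ∃ λ c → Nontrivial c × (∀ x → lincomb v c x ≡ 0ℚ)

InSpan : ∀ {j d} → (Fin j → Vector ℚ d) → Vector ℚ d → Set
InSpan u v = ∃ λ e → ∀ x → v x ≡ lincomb u e x

unit : ∀ {d} → Fin (suc d) → Vector ℚ (suc d)
unit i = insertAt (λ _ → 0ℚ) i 1ℚ

lincomb-unit : ∀ {p d} (v : Fin (suc p) → Vector ℚ d) (i : Fin (suc p)) x →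
  lincomb v (unit i) x ≡ v i x
lincomb-unit {p} v i x = begin
  lincomb v e x
    ≡⟨ sum-remove {i = i} (λ j → e j * v j x) ⟩
  e i * v i x + ∑[ k < p ] (e (punchIn i k) * v (punchIn i k) x)
    ≡⟨ cong₂ (λ a s → a * v i x + s) (insertAt-lookup (λ _ → 0ℚ) i 1ℚ)
         (∑-zero _ (λ k → trans (cong (_* v (punchIn i k) x) (insertAt-punchIn (λ _ → 0ℚ) i 1ℚ k))
                                (ℚP.*-zeroˡ (v (punchIn i k) x)))) ⟩
  1ℚ * v i x + 0ℚ
    ≡⟨ solve 1 (λ a → con 1ℚ :* a :+ con 0ℚ := a) refl (v i x) ⟩
  v i x ∎
  where
  open ≡-Reasoning
  e = unit i

lincomb-lincomb : ∀ {p j d} (u : Fin j → Vector ℚ d) (e : Fin p → Vector ℚ j) (c : Vector ℚ p) x →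
  lincomb (λ i → lincomb u (e i)) c x ≡ lincomb u (lincomb e c) x
lincomb-lincomb {p} {j} u e c x = begin
  ∑[ i < p ] (c i * ∑[ l < j ] (e i l * u l x))
    ≡⟨ sum-cong-≗ (λ i → *-distribˡ-sum (c i) (λ l → e i l * u l x)) ⟩
  ∑[ i < p ] ∑[ l < j ] (c i * (e i l * u l x))
    ≡⟨ ∑-comm (λ i l → c i * (e i l * u l x)) ⟩
  ∑[ l < j ] ∑[ i < p ] (c i * (e i l * u l x))
    ≡⟨ sum-cong-≗ (λ l → sum-cong-≗ (λ i → sym (ℚP.*-assoc (c i) (e i l) (u l x)))) ⟩
  ∑[ l < j ] ∑[ i < p ] (c i * e i l * u l x)
    ≡⟨ sum-cong-≗ (λ l → sym (*-distribʳ-sum (u l x) (λ i → c i * e i l))) ⟩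
  ∑[ l < j ] (∑[ i < p ] (c i * e i l) * u l x) ∎
  where open ≡-Reasoning

span-lincomb : ∀ {p j d} (u : Fin j → Vector ℚ d) (v : Fin p → Vector ℚ d) (c : Vector ℚ p) →
  (∀ i → InSpan u (v i)) → InSpan u (lincomb v c)
span-lincomb u v c v∈span = lincomb (λ i → proj₁ (v∈span i)) c , λ x →
  trans (sum-cong-≗ (λ i → cong (c i *_) (proj₂ (v∈span i) x)))
        (lincomb-lincomb u (λ i → proj₁ (v∈span i)) c x)

eliminate : ∀ {p d} (v : Fin (suc p) → Vector ℚ d) (i : Fin (suc p)) (r c' : Vector ℚ p) y →
  lincomb v (insertAt c' i (∑[ k < p ] (- (c' k * r k)))) y
    ≡ ∑[ k < p ] (c' k * (v (punchIn i k) y + - (r k * v i y)))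
eliminate {p} v i r c' y = begin
  lincomb v c y
    ≡⟨ sum-remove {i = i} (λ j → c j * v j y) ⟩
  c i * v i y + ∑[ k < p ] (c (punchIn i k) * v (punchIn i k) y)
    ≡⟨ cong₂ (λ a s → a * v i y + s) (insertAt-lookup c' i ci)
             (sum-cong-≗ λ k → cong (_* v (punchIn i k) y) (insertAt-punchIn c' i ci k)) ⟩
  ci * v i y + ∑[ k < p ] (c' k * v (punchIn i k) y)
    ≡⟨ cong (_+ ∑[ k < p ] (c' k * v (punchIn i k) y)) (*-distribʳ-sum (v i y) (λ k → - (c' k * r k))) ⟩
  ∑[ k < p ] (- (c' k * r k) * v i y) + ∑[ k < p ] (c' k * v (punchIn i k) y)
    ≡⟨ sym (∑-distrib-+ (λ k → - (c' k * r k) * v i y) (λ k → c' k * v (punchIn i k) y)) ⟩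
  ∑[ k < p ] (- (c' k * r k) * v i y + c' k * v (punchIn i k) y)
    ≡⟨ sum-cong-≗ (λ k → solve 4 (λ a ρ b u → :- (a :* ρ) :* b :+ a :* u := a :* (u :+ :- (ρ :* b)))
                                  refl (c' k) (r k) (v i y) (v (punchIn i k) y)) ⟩
  ∑[ k < p ] (c' k * (v (punchIn i k) y + - (r k * v i y))) ∎
  where
  open ≡-Reasoning
  ci = ∑[ k < p ] (- (c' k * r k))
  c = insertAt c' i ci

-- More vectors than coordinates: any p vectors in ℚᵈ with d < p are
-- linearly dependent (Gaussian elimination on the first coordinate).
more-vectors-than-coordinates : ∀ {p d} → d ℕ.< p → (v : Fin p → Vector ℚ d) → Dependent v
more-vectors-than-coordinates {suc p} {zero} _ v = (λ _ → 1ℚ) , (Fin.zero , λ ()) , λ ()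
more-vectors-than-coordinates {suc p} {suc d} (s≤s d<p) v
  with FinP.any? (λ i → ¬? (v i Fin.zero ℚP.≟ 0ℚ))
... | no no-pivot = c , nontrivial , combination
  where
  -- every vector has first coordinate 0: drop that coordinate
  first≡0 : ∀ i → v i Fin.zero ≡ 0ℚ
  first≡0 i = decidable-stable (v i Fin.zero ℚP.≟ 0ℚ) (λ ne → no-pivot (i , ne))
  rest = more-vectors-than-coordinates (ℕP.m<n⇒m<1+n d<p) (λ i → v i ∘ Fin.suc)
  c = proj₁ rest
  nontrivial = proj₁ (proj₂ rest)
  combination : ∀ x → lincomb v c x ≡ 0ℚ
  combination Fin.zero = ∑-zero _ (λ i → trans (cong (c i *_) (first≡0 i)) (ℚP.*-zeroʳ (c i)))
  combination (Fin.suc x) = proj₂ (proj₂ rest) x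
... | yes (i , pivot≢0) = c , nontrivial , combination
  where
  pivot = v i Fin.zero
  instance _ = ℚ.≢-nonZero pivot≢0
  -- ratios making the first coordinates of v (punchIn i k) - rₖ · v i vanish
  r : Vector ℚ p
  r k = v (punchIn i k) Fin.zero * 1/ pivot
  reduced = more-vectors-than-coordinates d<p
    (λ k x → v (punchIn i k) (Fin.suc x) + - (r k * v i (Fin.suc x)))
  c' = proj₁ reduced
  c = insertAt c' i (∑[ k < p ] (- (c' k * r k)))
  nontrivial : Nontrivial c
  nontrivial with proj₁ (proj₂ reduced)
  ... | k , c'ₖ≢0 = punchIn i k , λ cₖ≡0 → c'ₖ≢0 (trans (sym (insertAt-punchIn c' i _ k)) cₖ≡0)
  first-cancels : ∀ k → v (punchIn i k) Fin.zero + - (r k * pivot) ≡ 0ℚ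
  first-cancels k = begin
    a + - (a * 1/ pivot * pivot) ≡⟨ cong (λ t → a + - t) (ℚP.*-assoc a (1/ pivot) pivot) ⟩
    a + - (a * (1/ pivot * pivot)) ≡⟨ cong (λ t → a + - (a * t)) (ℚP.*-inverseˡ pivot) ⟩
    a + - (a * 1ℚ) ≡⟨ solve 1 (λ a → a :+ :- (a :* con 1ℚ) := con 0ℚ) refl a ⟩
    0ℚ ∎
    where
    open ≡-Reasoning
    a = v (punchIn i k) Fin.zero
  combination : ∀ x → lincomb v c x ≡ 0ℚ
  combination Fin.zero = trans (eliminate v i r c' Fin.zero)
    (∑-zero _ (λ k → trans (cong (c' k *_) (first-cancels k)) (ℚP.*-zeroʳ (c' k))))
  combination (Fin.suc x) = trans (eliminate v i r c' (Fin.suc x)) (proj₂ (proj₂ reduced) x)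

span-dependent : ∀ {p j d} → j ℕ.< p → (u : Fin j → Vector ℚ d) (v : Fin p → Vector ℚ d) →
  (∀ i → InSpan u (v i)) → Dependent v
span-dependent j<p u v v∈span = c , nontrivial , combination
  where
  e = λ i → proj₁ (v∈span i)
  coefficients-dependent = more-vectors-than-coordinates j<p e
  c = proj₁ coefficients-dependent
  nontrivial = proj₁ (proj₂ coefficients-dependent)
  combination : ∀ x → lincomb v c x ≡ 0ℚ
  combination x = begin
    lincomb v c x
      ≡⟨ sum-cong-≗ (λ i → cong (c i *_) (proj₂ (v∈span i) x)) ⟩
    lincomb (λ i → lincomb u (e i)) c x
      ≡⟨ lincomb-lincomb u e c x ⟩
    lincomb u (lincomb e c) x
      ≡⟨ ∑-zero _ (λ l → trans (cong (_* u l x) (proj₂ (proj₂ coefficients-dependent) l)) (ℚP.*-zeroˡ (u l x))) ⟩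
    0ℚ ∎
    where open ≡-Reasoning

solve-for : ∀ {p d} (u : Fin p → Vector ℚ d) (e : Vector ℚ p) (v : Vector ℚ d) {γ : ℚ} → γ ≢ 0ℚ →
  (∀ x → lincomb u e x + γ * v x ≡ 0ℚ) → InSpan u v
solve-for {p} u e v {γ} γ≢0 rel = (λ k → - (e k * 1/ γ)) , λ x →
  let S = lincomb u e x in begin
  v x                                   ≡⟨ solve 1 (λ a → a := con 1ℚ :* a) refl (v x) ⟩
  1ℚ * v x                              ≡⟨ cong (_* v x) (ℚP.*-inverseˡ γ) ⟨
  1/ γ * γ * v x                        ≡⟨ solve 4 (λ q c a s → q :* c :* a := (:- q) :* s :+ q :* (s :+ c :* a))
                                             refl (1/ γ) γ (v x) S ⟩
  (- 1/ γ) * S + 1/ γ * (S + γ * v x)   ≡⟨ cong (λ t → (- 1/ γ) * S + 1/ γ * t) (rel x) ⟩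
  (- 1/ γ) * S + 1/ γ * 0ℚ              ≡⟨ solve 2 (λ q s → (:- q) :* s :+ q :* con 0ℚ := (:- q) :* s) refl (1/ γ) S ⟩
  (- 1/ γ) * S                          ≡⟨ *-distribˡ-sum (- 1/ γ) (λ k → e k * u k x) ⟩
  ∑[ k < p ] ((- 1/ γ) * (e k * u k x)) ≡⟨ sum-cong-≗ (λ k → solve 3 (λ q c a → (:- q) :* (c :* a) := :- (c :* q) :* a)
                                                                     refl (1/ γ) (e k) (u k x)) ⟩
  lincomb u (λ k → - (e k * 1/ γ)) x ∎
  where
  open ≡-Reasoning
  instance _ = ℚ.≢-nonZero γ≢0

_·_ : ∀ {d} → (Fin d → Fin d → ℚ) → Vector ℚ d → Vector ℚ d
(M · v) x = ∑[ u < _ ] (M x u * v u)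

·-lincomb : ∀ {p d} (M : Fin d → Fin d → ℚ) (v : Fin p → Vector ℚ d) (c : Vector ℚ p) x →
  (M · lincomb v c) x ≡ lincomb (λ i → M · v i) c x
·-lincomb {p} {d} M v c x = begin
  ∑[ u < d ] (M x u * lincomb v c u)
    ≡⟨ sum-cong-≗ (λ u → ℚP.*-comm (M x u) _) ⟩
  lincomb columns (lincomb v c) x
    ≡⟨ sym (lincomb-lincomb columns v c x) ⟩
  lincomb (λ i → lincomb columns (v i)) c x
    ≡⟨ sum-cong-≗ (λ i → cong (c i *_) (sum-cong-≗ (λ u → ℚP.*-comm (v i u) (M x u)))) ⟩
  lincomb (λ i → M · v i) c x ∎
  where
  open ≡-Reasoning
  columns : Fin d → Vector ℚ d
  columns u y = M y u

·-unit : ∀ {d} (B : Fin (suc d) → Fin (suc d) → ℚ) (a : Fin (suc d)) x → (B · unit a) x ≡ B x a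
·-unit B a x = trans (sum-cong-≗ (λ u → ℚP.*-comm (B x u) (unit a u))) (lincomb-unit (λ u y → B y u) a x)

·-difference : ∀ {d} (P Q : Fin d → Fin d → ℚ) (v : Vector ℚ d) x →
  ((λ y u → P y u + - Q y u) · v) x ≡ (P · v) x + - (Q · v) x
·-difference {d} P Q v x = begin
  ∑[ u < d ] ((P x u + - Q x u) * v u)
    ≡⟨ sum-cong-≗ (λ u → solve 3 (λ p q a → (p :+ :- q) :* a := p :* a :+ con (- 1ℚ) :* (q :* a))
                                   refl (P x u) (Q x u) (v u)) ⟩
  ∑[ u < d ] (P x u * v u + - 1ℚ * (Q x u * v u))
    ≡⟨ ∑-distrib-+ (λ u → P x u * v u) (λ u → - 1ℚ * (Q x u * v u)) ⟩
  (P · v) x + ∑[ u < d ] (- 1ℚ * (Q x u * v u))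
    ≡⟨ cong ((P · v) x +_) (*-distribˡ-sum (- 1ℚ) (λ u → Q x u * v u)) ⟨
  (P · v) x + - 1ℚ * (Q · v) x
    ≡⟨ cong ((P · v) x +_) (solve 1 (λ a → con (- 1ℚ) :* a := :- a) refl ((Q · v) x)) ⟩
  (P · v) x + - (Q · v) x ∎
  where open ≡-Reasoning

zero-coefficient : ∀ s t {α β} → α ≡ 0ℚ → β ≢ 0ℚ → s * α + t * β ≡ 0ℚ → t ≡ 0ℚ
zero-coefficient s t {α} {β} α≡0 β≢0 eq = begin
  t                        ≡⟨ solve 1 (λ t → t := t :* con 1ℚ) refl t ⟩
  t * 1ℚ                   ≡⟨ cong (t *_) (ℚP.*-inverseʳ β) ⟨
  t * (β * 1/ β)           ≡⟨ solve 4 (λ s t b q → t :* (b :* q) := (s :* con 0ℚ :+ t :* b) :* q) refl s t β (1/ β) ⟩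
  (s * 0ℚ + t * β) * 1/ β  ≡⟨ cong (λ a → (s * a + t * β) * 1/ β) α≡0 ⟨
  (s * α + t * β) * 1/ β   ≡⟨ cong (_* 1/ β) eq ⟩
  0ℚ * 1/ β                ≡⟨ ℚP.*-zeroˡ (1/ β) ⟩
  0ℚ ∎
  where
  open ≡-Reasoning
  instance _ = ℚ.≢-nonZero β≢0

-- A matrix with a principal 2×2 block  [[0, β], [γ, 0]],  β, γ ≠ 0,  has rank
-- at least 2, so any m vectors of ℚ^{m+1} that it annihilates are dependent:
-- a dependence among  e_a, e_b, w₀, …, w_{m-1}  cannot involve e_a or e_b.
annihilated-dependent : ∀ {m} (B : Fin (suc m) → Fin (suc m) → ℚ) (w : Fin m → Vector ℚ (suc m)) →
  (∀ k x → (B · w k) x ≡ 0ℚ) →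
  ∀ a b → B a a ≡ 0ℚ → B b b ≡ 0ℚ → B a b ≢ 0ℚ → B b a ≢ 0ℚ → Dependent w
annihilated-dependent {m} B w Bw≡0 a b Baa≡0 Bbb≡0 Bab≢0 Bba≢0 = cw , nontrivial , rel
  where
  V : Fin (suc (suc m)) → Vector ℚ (suc m)
  V Fin.zero = unit a
  V (Fin.suc Fin.zero) = unit b
  V (Fin.suc (Fin.suc k)) = w k
  dependence = more-vectors-than-coordinates (ℕP.n<1+n (suc m)) V
  c = proj₁ dependence
  c₀ = c Fin.zero
  c₁ = c (Fin.suc Fin.zero)
  cw = c ∘ Fin.suc ∘ Fin.suc
  -- applying B to the dependence leaves  c₀ B_{xa} + c₁ B_{xb} = 0
  image : ∀ x → c₀ * B x a + c₁ * B x b ≡ 0ℚ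
  image x = begin
    c₀ * B x a + c₁ * B x b
      ≡⟨ solve 2 (λ s t → s :+ t := s :+ (t :+ con 0ℚ)) refl (c₀ * B x a) (c₁ * B x b) ⟩
    c₀ * B x a + (c₁ * B x b + 0ℚ)
      ≡⟨ cong₂ (λ s t → c₀ * s + (c₁ * t + 0ℚ)) (·-unit B a x) (·-unit B b x) ⟨
    c₀ * (B · unit a) x + (c₁ * (B · unit b) x + 0ℚ)
      ≡⟨ cong (λ t → c₀ * (B · unit a) x + (c₁ * (B · unit b) x + t))
              (∑-zero _ (λ k → trans (cong (cw k *_) (Bw≡0 k x)) (ℚP.*-zeroʳ (cw k)))) ⟨
    lincomb (λ i → B · V i) c x
      ≡⟨ ·-lincomb B V c x ⟨
    (B · lincomb V c) x
      ≡⟨ ∑-zero _ (λ u → trans (cong (B x u *_) (proj₂ (proj₂ dependence) u)) (ℚP.*-zeroʳ (B x u))) ⟩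
    0ℚ ∎
    where open ≡-Reasoning
  c₁≡0 : c₁ ≡ 0ℚ
  c₁≡0 = zero-coefficient c₀ c₁ Baa≡0 Bab≢0 (image a)
  c₀≡0 : c₀ ≡ 0ℚ
  c₀≡0 = zero-coefficient c₁ c₀ Bbb≡0 Bba≢0 (trans (ℚP.+-comm (c₁ * B b b) (c₀ * B b a)) (image b))
  nontrivial : Nontrivial cw
  nontrivial with proj₁ (proj₂ dependence)
  ... | Fin.zero , c₀≢0 = ⊥-elim (c₀≢0 c₀≡0)
  ... | Fin.suc Fin.zero , c₁≢0 = ⊥-elim (c₁≢0 c₁≡0)
  ... | Fin.suc (Fin.suc k) , cₖ≢0 = k , cₖ≢0
  rel : ∀ x → lincomb w cw x ≡ 0ℚ
  rel x = begin
    lincomb w cw x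
      ≡⟨ solve 3 (λ s t r → r := con 0ℚ :* s :+ (con 0ℚ :* t :+ r)) refl (unit a x) (unit b x) (lincomb w cw x) ⟩
    0ℚ * unit a x + (0ℚ * unit b x + lincomb w cw x)
      ≡⟨ cong₂ (λ s t → s * unit a x + (t * unit b x + lincomb w cw x)) c₀≡0 c₁≡0 ⟨
    lincomb V c x
      ≡⟨ proj₂ (proj₂ dependence) x ⟩
    0ℚ ∎
    where open ≡-Reasoning

module Krylov {d : ℕ} (M : Fin d → Fin d → ℚ) (w : ℕ → Vector ℚ d)
              (w-step : ∀ k x → w (suc k) x ≡ (M · w k) x) where

  prefix : ∀ j → Fin j → Vector ℚ d
  prefix j i = w (toℕ i)

  prefix-in-span : ∀ {j} m → m ℕ.< j → InSpan (prefix j) (w m)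
  prefix-in-span {suc j} m m<j = unit i , λ x →
    sym (trans (lincomb-unit (prefix (suc j)) i x) (cong (λ t → w t x) (FinP.toℕ-fromℕ< m<j)))
    where i = Fin.fromℕ< m<j

  -- Once w_j lies in the span of w₀, …, w_{j-1}, so does every w_t:
  -- applying A to a combination of w₀, …, w_{j-1} gives one of w₁, …, w_j.
  span-closed : ∀ j → InSpan (prefix j) (w j) → ∀ t → InSpan (prefix j) (w t)
  span-closed zero    wⱼ∈span zero = wⱼ∈span
  span-closed (suc j) wⱼ∈span zero = prefix-in-span zero (s≤s z≤n)
  span-closed j wⱼ∈span (suc t) with span-closed j wⱼ∈span t
  ... | e , wₜ≡ = proj₁ shifted∈span , λ x → begin
    w (suc t) x                            ≡⟨ w-step t x ⟩
    (M · w t) x                            ≡⟨ sum-cong-≗ (λ u → cong (M x u *_) (wₜ≡ u)) ⟩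
    (M · lincomb (prefix j) e) x           ≡⟨ ·-lincomb M (prefix j) e x ⟩
    lincomb (λ i → M · prefix j i) e x     ≡⟨ sum-cong-≗ (λ i → cong (e i *_) (sym (w-step (toℕ i) x))) ⟩
    lincomb shifted e x                    ≡⟨ proj₂ shifted∈span x ⟩
    lincomb (prefix j) (proj₁ shifted∈span) x ∎
    where
    open ≡-Reasoning
    shifted : Fin j → Vector ℚ d
    shifted i = w (suc (toℕ i))
    shifted-in-span : ∀ i → InSpan (prefix j) (shifted i)
    shifted-in-span i with suc (toℕ i) ℕP.≟ j
    ... | yes i+1≡j = subst (λ m → InSpan (prefix j) (w m)) (sym i+1≡j) wⱼ∈span
    ... | no  i+1≢j = prefix-in-span (suc (toℕ i)) (ℕP.≤∧≢⇒< (FinP.toℕ<n i) i+1≢j)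
    shifted∈span = span-lincomb (prefix j) shifted e shifted-in-span

  lincomb-prefix-last : ∀ p (c : Vector ℚ (suc p)) x →
    lincomb (prefix (suc p)) c x ≡ lincomb (prefix p) (c ∘ Fin.inject₁) x + c (Fin.fromℕ p) * w p x
  lincomb-prefix-last p c x = trans (sum-init-last (λ i → c i * w (toℕ i) x))
    (cong₂ _+_ (sum-cong-≗ (λ k → cong (λ t → c (Fin.inject₁ k) * w t x) (FinP.toℕ-inject₁ k)))
               (cong (λ t → c (Fin.fromℕ p) * w t x) (FinP.toℕ-fromℕ p)))

  drop-last : ∀ p (c : Vector ℚ (suc p)) → Nontrivial c → c (Fin.fromℕ p) ≡ 0ℚ →
    (∀ x → lincomb (prefix (suc p)) c x ≡ 0ℚ) → Dependent (prefix p)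
  drop-last p c (i , cᵢ≢0) cₚ≡0 rel = c ∘ Fin.inject₁ , nontrivial , rel′
    where
    i≢last : p ≢ toℕ i
    i≢last p≡i = cᵢ≢0 (trans (cong c (FinP.toℕ-injective (trans (sym p≡i) (sym (FinP.toℕ-fromℕ p))))) cₚ≡0)
    nontrivial : Nontrivial (c ∘ Fin.inject₁)
    nontrivial = Fin.lower₁ i i≢last , λ c≡0 → cᵢ≢0 (trans (cong c (sym (FinP.inject₁-lower₁ i i≢last))) c≡0)
    rel′ : ∀ x → lincomb (prefix p) (c ∘ Fin.inject₁) x ≡ 0ℚ
    rel′ x = begin
      lincomb (prefix p) (c ∘ Fin.inject₁) x
        ≡⟨ ℚP.+-identityʳ _ ⟨
      lincomb (prefix p) (c ∘ Fin.inject₁) x + 0ℚ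
        ≡⟨ cong (lincomb (prefix p) (c ∘ Fin.inject₁) x +_) (trans (cong (_* w p x) cₚ≡0) (ℚP.*-zeroˡ (w p x))) ⟨
      lincomb (prefix p) (c ∘ Fin.inject₁) x + c (Fin.fromℕ p) * w p x
        ≡⟨ lincomb-prefix-last p c x ⟨
      lincomb (prefix (suc p)) c x
        ≡⟨ rel x ⟩
      0ℚ ∎
      where open ≡-Reasoning

  -- If w₀, …, w_{m-1} are dependent, then some w_j with j < m lies in the
  -- span of its predecessors: solve for the last nonzero coefficient.
  first-dependence : ∀ m → Dependent (prefix m) → ∃ λ j → j ℕ.< m × InSpan (prefix j) (w j)
  first-dependence zero (c , (() , _) , _)
  first-dependence (suc p) (c , nontrivial , rel) with c (Fin.fromℕ p) ℚP.≟ 0ℚ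
  ... | no cₚ≢0 = p , ℕP.n<1+n p ,
    solve-for (prefix p) (c ∘ Fin.inject₁) (w p) cₚ≢0 (λ x → trans (sym (lincomb-prefix-last p c x)) (rel x))
  ... | yes cₚ≡0 =
    let j , j<p , wⱼ∈span = first-dependence p (drop-last p c nontrivial cₚ≡0 rel)
    in  j , ℕP.m<n⇒m<1+n j<p , wⱼ∈span

  -- The rank of a Krylov sequence is attained by an initial segment: if
  -- w₀, …, w_{m-1} are dependent, then any m members of the sequence are.
  krylov-rank : ∀ m → Dependent (prefix m) → (ks : Fin m → ℕ) → Dependent (λ i → w (ks i))
  krylov-rank m dep ks with first-dependence m dep
  ... | j , j<m , wⱼ∈span =
    span-dependent j<m (prefix j) (λ i → w (ks i)) (λ i → span-closed j wⱼ∈span (ks i))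

-- Walk counts.  The definitions count walks in ℕ; the linear algebra is
-- done after embedding the counts into ℚ.

sumFin≡∑ : ∀ {n} (f : Fin n → ℕ) → sumFin f ≡ ℕΣ.sum f
sumFin≡∑ {zero}  f = refl
sumFin≡∑ {suc n} f = cong (f Fin.zero ℕ.+_) (sumFin≡∑ (f ∘ Fin.suc))

sumFinℚ≡∑ : ∀ {n} (f : Fin n → ℚ) → sumFinℚ f ≡ ∑[ i < n ] f i
sumFinℚ≡∑ {zero}  f = refl
sumFinℚ≡∑ {suc n} f = cong (f Fin.zero +_) (sumFinℚ≡∑ (f ∘ Fin.suc))

toℚᵘ-toℚ : ∀ a → ℚ.toℚᵘ (toℚ a) ℚᵘ.≃ ℚᵘ.mkℚᵘ (ℤ.+ a) 0
toℚᵘ-toℚ a = ℚP.toℚᵘ-fromℚᵘ (ℚᵘ.mkℚᵘ (ℤ.+ a) 0)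

toℚ-+ : ∀ a b → toℚ (a ℕ.+ b) ≡ toℚ a + toℚ b
toℚ-+ a b = ℚP.toℚᵘ-injective (begin
  ℚ.toℚᵘ (toℚ (a ℕ.+ b))                         ≈⟨ toℚᵘ-toℚ (a ℕ.+ b) ⟩
  ℚᵘ.mkℚᵘ (ℤ.+ (a ℕ.+ b)) 0                      ≈⟨ ℚᵘ.*≡* numerators ⟩
  ℚᵘ.mkℚᵘ (ℤ.+ a) 0 ℚᵘ.+ ℚᵘ.mkℚᵘ (ℤ.+ b) 0       ≈⟨ ℚᵘP.+-cong (toℚᵘ-toℚ a) (toℚᵘ-toℚ b) ⟨
  ℚ.toℚᵘ (toℚ a) ℚᵘ.+ ℚ.toℚᵘ (toℚ b)             ≈⟨ ℚP.toℚᵘ-homo-+ (toℚ a) (toℚ b) ⟨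
  ℚ.toℚᵘ (toℚ a + toℚ b) ∎)
  where
  open ℚᵘP.≃-Reasoning
  numerators : ℤ.+ (a ℕ.+ b) ℤ.* ℤ.+ 1 ≡ (ℤ.+ a ℤ.* ℤ.+ 1 ℤ.+ ℤ.+ b ℤ.* ℤ.+ 1) ℤ.* ℤ.+ 1
  numerators = cong (ℤ._* ℤ.+ 1) (trans (ℤP.pos-+ a b)
    (sym (cong₂ ℤ._+_ (ℤP.*-identityʳ (ℤ.+ a)) (ℤP.*-identityʳ (ℤ.+ b)))))

toℚ-* : ∀ a b → toℚ (a ℕ.* b) ≡ toℚ a * toℚ b
toℚ-* a b = ℚP.toℚᵘ-injective (begin
  ℚ.toℚᵘ (toℚ (a ℕ.* b))                         ≈⟨ toℚᵘ-toℚ (a ℕ.* b) ⟩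
  ℚᵘ.mkℚᵘ (ℤ.+ (a ℕ.* b)) 0                      ≈⟨ ℚᵘ.*≡* (cong (ℤ._* ℤ.+ 1) (ℤP.pos-* a b)) ⟩
  ℚᵘ.mkℚᵘ (ℤ.+ a) 0 ℚᵘ.* ℚᵘ.mkℚᵘ (ℤ.+ b) 0       ≈⟨ ℚᵘP.*-cong (toℚᵘ-toℚ a) (toℚᵘ-toℚ b) ⟨
  ℚ.toℚᵘ (toℚ a) ℚᵘ.* ℚ.toℚᵘ (toℚ b)             ≈⟨ ℚP.toℚᵘ-homo-* (toℚ a) (toℚ b) ⟨
  ℚ.toℚᵘ (toℚ a * toℚ b) ∎)
  where open ℚᵘP.≃-Reasoning

toℚ-sumFin : ∀ {n} (f : Fin n → ℕ) → toℚ (sumFin f) ≡ ∑[ i < n ] toℚ (f i)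
toℚ-sumFin {zero}  f = refl
toℚ-sumFin {suc n} f = trans (toℚ-+ (f Fin.zero) _) (cong (toℚ (f Fin.zero) +_) (toℚ-sumFin (f ∘ Fin.suc)))

-- Walk counts are invariant under isomorphism: relabel the summation over
-- the next vertex of the walk.
walks-iso : ∀ {n m} (G : Graph n) (H : Graph m) (σ : Fin n ↔ Fin m) →
  (∀ u v → adj G u v ≡ adj H (σ ⟨$⟩ʳ u) (σ ⟨$⟩ʳ v)) → ∀ k v → walks G k v ≡ walks H k (σ ⟨$⟩ʳ v)
walks-iso G H σ σ-adj zero    v = refl
walks-iso G H σ σ-adj (suc k) v = begin
  sumFin (λ u → A G v u ℕ.* walks G k u)
    ≡⟨ sumFin≡∑ (λ u → A G v u ℕ.* walks G k u) ⟩
  ℕΣ.sum (λ u → A G v u ℕ.* walks G k u)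
    ≡⟨ ℕΣ.sum-cong-≗ (λ u → cong₂ ℕ._*_ (cong (λ b → if b then 1 else 0) (σ-adj v u))
                                        (walks-iso G H σ σ-adj k u)) ⟩
  ℕΣ.sum (λ u → A H (σ ⟨$⟩ʳ v) (σ ⟨$⟩ʳ u) ℕ.* walks H k (σ ⟨$⟩ʳ u))
    ≡⟨ ℕΣ.sum-permute (λ u′ → A H (σ ⟨$⟩ʳ v) u′ ℕ.* walks H k u′) σ ⟨
  ℕΣ.sum (λ u′ → A H (σ ⟨$⟩ʳ v) u′ ℕ.* walks H k u′)
    ≡⟨ sumFin≡∑ (λ u′ → A H (σ ⟨$⟩ʳ v) u′ ℕ.* walks H k u′) ⟨
  sumFin (λ u′ → A H (σ ⟨$⟩ʳ v) u′ ℕ.* walks H k u′) ∎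
  where open ≡-Reasoning

walksℚ : ∀ {n} → Graph n → ℕ → Vector ℚ n
walksℚ G k v = toℚ (walks G k v)

adjℚ : ∀ {n} → Graph n → Fin n → Fin n → ℚ
adjℚ G u v = toℚ (A G u v)

walksℚ-step : ∀ {n} (G : Graph n) k x → walksℚ G (suc k) x ≡ (adjℚ G · walksℚ G k) x
walksℚ-step G k x = trans (toℚ-sumFin (λ u → A G x u ℕ.* walks G k u))
                          (sum-cong-≗ (λ u → toℚ-* (A G x u) (walks G k u)))

indicator-difference : ∀ p q → toℚ (if p then 1 else 0) + - toℚ (if q then 1 else 0) ≡ 0ℚ → p ≡ q
indicator-difference false false _ = refl
indicator-difference true  true  _ = refl
indicator-difference false true  ()
indicator-difference true  false ()

Δ : ∀ {n} → Graph n → Graph n → Fin n → Fin n → ℚ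
Δ G H y u = adjℚ G y u + - adjℚ H y u

Δ-diagonal : ∀ {n} (G H : Graph n) x → Δ G H x x ≡ 0ℚ
Δ-diagonal G H x = cong₂ (λ p q → toℚ (if p then 1 else 0) + - toℚ (if q then 1 else 0))
                         (loopless G x) (loopless H x)

Δ-symmetric : ∀ {n} (G H : Graph n) a b → Δ G H a b ≡ Δ G H b a
Δ-symmetric G H a b = cong₂ (λ p q → toℚ (if p then 1 else 0) + - toℚ (if q then 1 else 0))
                            (Graph.sym G a b) (Graph.sym H a b)

Δ-zero : ∀ {n} (G H : Graph n) a b → Δ G H a b ≡ 0ℚ → adj G a b ≡ adj H a b
Δ-zero G H a b = indicator-difference (adj G a b) (adj H a b)

difference-annihilates : ∀ {n} (G H : Graph n) j →
  (∀ v → walks G j v ≡ walks H j v) → (∀ v → walks G (suc j) v ≡ walks H (suc j) v) →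
  ∀ x → (Δ G H · walksℚ G j) x ≡ 0ℚ
difference-annihilates G H j same-j same-j+1 x = begin
  (Δ G H · walksℚ G j) x
    ≡⟨ ·-difference (adjℚ G) (adjℚ H) (walksℚ G j) x ⟩
  (adjℚ G · walksℚ G j) x + - (adjℚ H · walksℚ G j) x
    ≡⟨ cong (λ t → (adjℚ G · walksℚ G j) x + - t)
            (sum-cong-≗ (λ u → cong (λ t → adjℚ H x u * toℚ t) (same-j u))) ⟩
  (adjℚ G · walksℚ G j) x + - (adjℚ H · walksℚ H j) x
    ≡⟨ cong₂ (λ s t → s + - t) (walksℚ-step G j x) (walksℚ-step H j x) ⟨
  walksℚ G (suc j) x + - walksℚ H (suc j) x
    ≡⟨ cong (λ t → walksℚ G (suc j) x + - toℚ t) (same-j+1 x) ⟨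
  walksℚ G (suc j) x + - walksℚ G (suc j) x
    ≡⟨ ℚP.+-inverseʳ (walksℚ G (suc j) x) ⟩
  0ℚ ∎
  where open ≡-Reasoning

-- Heart of the theorem: if rank W(G) ≥ n - 1, then G is determined by its
-- walk counts of lengths 0, …, n-1.  The symmetric, zero-diagonal matrix
-- Δ = A(G) - A(H) kills e, Ae, …, A^{n-2}e; these are independent by the
-- rank condition and the Krylov rank lemma, so Δ has no nonzero entry.
walk-determined : ∀ {n} (G H : Graph n) → RankAtLeast G (n ∸ 1) →
  (∀ k → k ℕ.< n → ∀ v → walks G k v ≡ walks H k v) → ∀ a b → adj G a b ≡ adj H a b
walk-determined {zero}  G H _ _ () _
walk-determined {suc m} G H (cols , _ , cols-independent) same-walks a b =
  Δ-zero G H a b (decidable-stable (Δ G H a b ℚP.≟ 0ℚ) λ Δab≢0 →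
    prefix-independent (annihilated-dependent (Δ G H) (prefix m) Δ-annihilates a b
      (Δ-diagonal G H a) (Δ-diagonal G H b) Δab≢0 (Δab≢0 ∘ trans (Δ-symmetric G H a b))))
  where
  open Krylov (adjℚ G) (walksℚ G) (walksℚ-step G)
  -- a dependence among e, …, A^{m-1}e would make the m chosen columns dependent
  prefix-independent : ¬ Dependent (prefix m)
  prefix-independent dependent = proj₂ nontrivial (cols-independent c rel (proj₁ nontrivial))
    where
    cols-dependent = krylov-rank m dependent (toℕ ∘ cols)
    c = proj₁ cols-dependent
    nontrivial = proj₁ (proj₂ cols-dependent)
    rel : ∀ v → sumFinℚ (λ i → c i * walksℚ G (toℕ (cols i)) v) ≡ 0ℚ
    rel v = trans (sumFinℚ≡∑ (λ i → c i * walksℚ G (toℕ (cols i)) v)) (proj₂ (proj₂ cols-dependent) v)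
  Δ-annihilates : ∀ (k : Fin m) x → (Δ G H · prefix m k) x ≡ 0ℚ
  Δ-annihilates k = difference-annihilates G H (toℕ k)
    (same-walks (toℕ k) (ℕP.m<n⇒m<1+n (FinP.toℕ<n k))) (same-walks (suc (toℕ k)) (s≤s (FinP.toℕ<n k)))

-- Sorting rows.  lexLeq is a decidable total order on rows, sortRows is
-- the library's insertion sort for it, and sorted permutations coincide.

_≤ˡ_ : List ℕ → List ℕ → Set
xs ≤ˡ ys = T (lexLeq xs ys)

lex-≡ : ∀ x xs ys → lexLeq (x ∷ xs) (x ∷ ys) ≡ lexLeq xs ys
lex-≡ x xs ys with x ≡ᵇ x | ℕP.≡⇒≡ᵇ x x refl
... | true | _ = refl

lex-< : ∀ {x y} xs ys → x ℕ.< y → (x ∷ xs) ≤ˡ (y ∷ ys)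
lex-< {x} {y} xs ys x<y with x ≡ᵇ y | ℕP.≡ᵇ⇒≡ x y
... | true  | x≡y = ⊥-elim (ℕP.<-irrefl (x≡y tt) x<y)
... | false | _   = ℕP.≤⇒≤ᵇ (ℕP.<⇒≤ x<y)

lex-> : ∀ {x y} xs ys → y ℕ.< x → ¬ (x ∷ xs) ≤ˡ (y ∷ ys)
lex-> {x} {y} xs ys y<x with x ≡ᵇ y | ℕP.≡ᵇ⇒≡ x y
... | true  | x≡y = ⊥-elim (ℕP.<-irrefl (sym (x≡y tt)) y<x)
... | false | _   = λ x≤y → ℕP.<⇒≱ y<x (ℕP.≤ᵇ⇒≤ x y x≤y)

≤ˡ-refl : ∀ xs → xs ≤ˡ xs
≤ˡ-refl []       = tt
≤ˡ-refl (x ∷ xs) = subst T (sym (lex-≡ x xs xs)) (≤ˡ-refl xs)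

≤ˡ-total : ∀ xs ys → xs ≤ˡ ys ⊎ ys ≤ˡ xs
≤ˡ-total []       ys       = inj₁ tt
≤ˡ-total (x ∷ xs) []       = inj₂ tt
≤ˡ-total (x ∷ xs) (y ∷ ys) with ℕP.<-cmp x y
... | tri< x<y _ _ = inj₁ (lex-< xs ys x<y)
... | tri> _ _ y<x = inj₂ (lex-< ys xs y<x)
... | tri≈ _ refl _ with ≤ˡ-total xs ys
...   | inj₁ xs≤ys = inj₁ (subst T (sym (lex-≡ x xs ys)) xs≤ys)
...   | inj₂ ys≤xs = inj₂ (subst T (sym (lex-≡ x ys xs)) ys≤xs)

≤ˡ-antisym : ∀ xs ys → xs ≤ˡ ys → ys ≤ˡ xs → xs ≡ ys
≤ˡ-antisym []       []       _ _ = refl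
≤ˡ-antisym (x ∷ xs) (y ∷ ys) p q with ℕP.<-cmp x y
... | tri< x<y _ _ = ⊥-elim (lex-> ys xs x<y q)
... | tri> _ _ y<x = ⊥-elim (lex-> xs ys y<x p)
... | tri≈ _ refl _ = cong (x ∷_) (≤ˡ-antisym xs ys (subst T (lex-≡ x xs ys) p) (subst T (lex-≡ x ys xs) q))

≤ˡ-trans : ∀ xs ys zs → xs ≤ˡ ys → ys ≤ˡ zs → xs ≤ˡ zs
≤ˡ-trans []       _        _        _ _ = tt
≤ˡ-trans (x ∷ xs) (y ∷ ys) (z ∷ zs) p q with ℕP.<-cmp x y | ℕP.<-cmp y z
... | tri> _ _ y<x | _ = ⊥-elim (lex-> xs ys y<x p)
... | _ | tri> _ _ z<y = ⊥-elim (lex-> ys zs z<y q)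
... | tri< x<y _ _ | tri< y<z _ _ = lex-< xs zs (ℕP.<-trans x<y y<z)
... | tri< x<y _ _ | tri≈ _ refl _ = lex-< xs zs x<y
... | tri≈ _ refl _ | tri< y<z _ _ = lex-< xs zs y<z
... | tri≈ _ refl _ | tri≈ _ refl _ =
  subst T (sym (lex-≡ x xs zs)) (≤ˡ-trans xs ys zs (subst T (lex-≡ x xs ys) p) (subst T (lex-≡ x ys zs) q))

-- Rows under lexLeq form a decidable total order whose decision procedure
-- is lexLeq itself, so its insertion sort is sortRows.
rowOrder : DecTotalOrder _ _ _
rowOrder = record
  { Carrier = List ℕ
  ; _≈_ = _≡_
  ; _≤_ = _≤ˡ_
  ; isDecTotalOrder = record
    { isTotalOrder = record
      { isPartialOrder = record
        { isPreorder = record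
          { isEquivalence = isEquivalence
          ; reflexive = λ { {xs} refl → ≤ˡ-refl xs }
          ; trans = λ {xs} {ys} {zs} → ≤ˡ-trans xs ys zs
          }
        ; antisym = λ {xs} {ys} → ≤ˡ-antisym xs ys
        }
      ; total = ≤ˡ-total
      }
    ; _≟_ = ListP.≡-dec ℕP._≟_
    ; _≤?_ = λ xs ys → T? (lexLeq xs ys)
    }
  }

import Data.List.Sort.InsertionSort.Base rowOrder as Sort
open DecTotalOrder rowOrder using (totalOrder)
open import Data.List.Sort.InsertionSort.Properties rowOrder using (sort-↭; sort-↗)

insert≡ : ∀ r ss → insert r ss ≡ Sort.insert r ss
insert≡ r []       = refl
insert≡ r (s ∷ ss) with lexLeq r s
... | true  = refl
... | false = cong (s ∷_) (insert≡ r ss)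

sortRows≡sort : ∀ rs → sortRows rs ≡ Sort.sort rs
sortRows≡sort []       = refl
sortRows≡sort (r ∷ rs) = trans (insert≡ r (sortRows rs)) (cong (Sort.insert r) (sortRows≡sort rs))

sortRows-perm : ∀ rs → sortRows rs ↭ rs
sortRows-perm rs = subst (_↭ rs) (sym (sortRows≡sort rs)) (sort-↭ rs)

sortRows-↭ : ∀ {xs ys} → xs ↭ ys → sortRows xs ≡ sortRows ys
sortRows-↭ {xs} {ys} xs↭ys = begin
  sortRows xs ≡⟨ sortRows≡sort xs ⟩
  Sort.sort xs ≡⟨ Pointwise-≡⇒≡ (↗↭↗⇒≋ totalOrder (sort-↗ xs) (sort-↗ ys)
                    (↭⇒↭ₛ (↭-trans (sort-↭ xs) (↭-trans xs↭ys (↭-sym (sort-↭ ys)))))) ⟩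
  Sort.sort ys ≡⟨ sortRows≡sort ys ⟨
  sortRows ys ∎
  where open ≡-Reasoning

module _ {A : Set} where
  module ↭Σ = Algebra.Properties.CommutativeMonoid.Sum (↭P.++-commutativeMonoid {A = A})
  open Data.List.Relation.Binary.Permutation.Setoid.Properties (setoid A) using (onIndices-lookup)

  tabulate-∑ : ∀ {n} (f : Fin n → A) → tabulate f ≡ ↭Σ.sum (λ i → f i ∷ [])
  tabulate-∑ {zero}  f = refl
  tabulate-∑ {suc n} f = cong (f Fin.zero ∷_) (tabulate-∑ (f ∘ Fin.suc))

  tabulate-permute : ∀ {m n} (f : Fin n → A) (π : Permutation m n) → tabulate f ↭ tabulate (f ∘ (π ⟨$⟩ʳ_))
  tabulate-permute f π = subst₂ _↭_ (sym (tabulate-∑ f)) (sym (tabulate-∑ (f ∘ (π ⟨$⟩ʳ_))))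
                                    (↭Σ.sum-permute (λ i → f i ∷ []) π)

  ↭⇒reindexing : ∀ {n m} (f : Fin n → A) (g : Fin m → A) → tabulate f ↭ tabulate g →
    Σ (Permutation n m) λ σ → ∀ i → f i ≡ g (σ ⟨$⟩ʳ i)
  ↭⇒reindexing f g f↭g = σ , f≡g∘σ
    where
    f↭ₛg = ↭⇒↭ₛ f↭g
    σ : Permutation _ _
    σ = cast-id (sym (ListP.length-tabulate f)) ∘ₚ (onIndices f↭ₛg ∘ₚ cast-id (ListP.length-tabulate g))
    f≡g∘σ : ∀ i → f i ≡ g (σ ⟨$⟩ʳ i)
    f≡g∘σ i = begin
      f i                                  ≡⟨ ListP.lookup-tabulate f i ⟨
      lookup (tabulate f) i′               ≡⟨ onIndices-lookup f↭ₛg i′ ⟩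
      lookup (tabulate g) j                ≡⟨ cong (lookup (tabulate g)) (FinP.cast-involutive (sym ℓg) ℓg j) ⟨
      lookup (tabulate g) (Fin.cast (sym ℓg) (Fin.cast ℓg j)) ≡⟨ ListP.lookup-tabulate g (Fin.cast ℓg j) ⟩
      g (σ ⟨$⟩ʳ i) ∎
      where
      open ≡-Reasoning
      ℓg = ListP.length-tabulate g
      i′ = Fin.cast (sym (ListP.length-tabulate f)) i
      j = onIndices f↭ₛg ⟨$⟩ʳ i′

Wrows-tabulate : ∀ {n} (G : Graph n) → Wrows G ≡ tabulate (Wrow G)
Wrows-tabulate G = ListP.map-tabulate (λ i → i) (Wrow G)

upTo-agree : ∀ {B : Set} (f g : ℕ → B) n → map f (upTo n) ≡ map g (upTo n) → ∀ k → k ℕ.< n → f k ≡ g k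
upTo-agree {B} f g n eq = applyUpTo-agree f g n
  (trans (sym (ListP.map-applyUpTo (λ i → i) f n)) (trans eq (ListP.map-applyUpTo (λ i → i) g n)))
  where
  applyUpTo-agree : ∀ (f g : ℕ → B) n → applyUpTo f n ≡ applyUpTo g n → ∀ k → k ℕ.< n → f k ≡ g k
  applyUpTo-agree f g (suc n) eq zero    _         = proj₁ (ListP.∷-injective eq)
  applyUpTo-agree f g (suc n) eq (suc k) (s≤s k<n) =
    applyUpTo-agree (f ∘ suc) (g ∘ suc) n (proj₂ (ListP.∷-injective eq)) k k<n

-- (⇒) An isomorphism reindexes the rows of W; sorting forgets the order.
iso⇒lex : ∀ {n m} (G : Graph n) (G* : Graph m) → Isomorphic G G* → lexW G ≡ lexW G*
iso⇒lex {n} G G* (σ , σ-adj) with ↔⇒≡ σ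
... | refl = sortRows-↭ (subst₂ _↭_ (sym (Wrows-tabulate G)) (sym (Wrows-tabulate G*)) rows-↭)
  where
  rows-agree : ∀ v → Wrow G v ≡ Wrow G* (σ ⟨$⟩ʳ v)
  rows-agree v = ListP.map-cong (λ k → walks-iso G G* σ σ-adj k v) (upTo n)
  rows-↭ : tabulate (Wrow G) ↭ tabulate (Wrow G*)
  rows-↭ = subst (_↭ tabulate (Wrow G*)) (sym (ListP.tabulate-cong rows-agree))
                 (↭-sym (tabulate-permute (Wrow G*) σ))

pullback : ∀ {n m} → Graph m → Fin n ↔ Fin m → Graph n
pullback G* σ = record
  { adj      = λ u v → adj G* (σ ⟨$⟩ʳ u) (σ ⟨$⟩ʳ v)
  ; sym      = λ u v → Graph.sym G* (σ ⟨$⟩ʳ u) (σ ⟨$⟩ʳ v)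
  ; loopless = λ v → loopless G* (σ ⟨$⟩ʳ v)
  }

-- If a bijection σ matches the rows of W and W*, then the pullback of G*
-- along σ has the walk counts of G, hence equals G: σ is an isomorphism.
rows⇒iso : ∀ {n m} (G : Graph n) (G* : Graph m) → RankAtLeast G (n ∸ 1) →
  (Σ (Fin n ↔ Fin m) λ σ → ∀ v → Wrow G v ≡ Wrow G* (σ ⟨$⟩ʳ v)) → Isomorphic G G*
rows⇒iso {n} G G* rank (σ , rows-agree) with ↔⇒≡ σ
... | refl = σ , walk-determined G (pullback G* σ) rank same-walks
  where
  same-walks : ∀ k → k ℕ.< n → ∀ v → walks G k v ≡ walks (pullback G* σ) k v
  same-walks k k<n v =
    trans (upTo-agree (λ k → walks G k v) (λ k → walks G* k (σ ⟨$⟩ʳ v)) n (rows-agree v) k k<n)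
          (sym (walks-iso (pullback G* σ) G* σ (λ _ _ → refl) k v))

lex⇒rows-↭ : ∀ {n m} (G : Graph n) (G* : Graph m) → lexW G ≡ lexW G* → tabulate (Wrow G) ↭ tabulate (Wrow G*)
lex⇒rows-↭ G G* lex≡ = subst₂ _↭_ (Wrows-tabulate G) (Wrows-tabulate G*)
  (↭-trans (↭-sym (sortRows-perm (Wrows G))) (subst (_↭ Wrows G*) (sym lex≡) (sortRows-perm (Wrows G*))))

theorem1p3 : ∀ {n m} (G : Graph n) (G* : Graph m) →
    RankAtLeast G (n ∸ 1) →
    Isomorphic G G* ⇔ (lexW G ≡ lexW G*)
theorem1p3 G G* rank = mk⇔
  (iso⇒lex G G*)
  (λ lex≡ → rows⇒iso G G* rank (↭⇒reindexing (Wrow G) (Wrow G*) (lex⇒rows-↭ G G* lex≡)))
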